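{- Let $r\geq 13$ be an integer and let $G$ be an $r$-minimal graph that is $1$-planar, drawn in the plane so that every edge is crossed by at most one other edge and the number of crossings is as small as possible. Then every face of degree $5$ in the associated plane graph $G^{\times}$ is incident with at most four vertices whose degree in $G^{\times}$ is at most $4$.
   Context: All graphs are finite, simple and undirected. A total $k$-coloring of a graph is a map from $V\cup E$ to $\{1,\dots,k\}$ assigning different colors to any two adjacent or incident elements. For an integer $r$, an $r$-minimal graph is a connected graph $G$ with maximum degree $\Delta(G)\leq r$ that has no total $(r+2)$-coloring, and that has the fewest edges among all connected graphs with maximum degree at most $r$ having no total $(r+2)$-coloring. A graph is $1$-planar if it can be drawn in the plane so that each edge is crossed by at most one other edge. Given such a drawing of $G$, the associated plane graph $G^{\times}$ is obtained by turning every crossing into a new vertex of degree $4$; these new vertices are called false, and the vertices of $G$ are called true. -}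

module Defs where

open import Data.Nat using (ℕ; zero; suc; _+_; _*_; _≤_; _<_; _≤ᵇ_)
open import Data.Fin using (Fin; toℕ; _↑ˡ_; _↑ʳ_)
open import Data.Fin.Properties using () renaming (_≟_ to _≟ᶠ_)
open import Data.Bool using (Bool; true; false; _∧_; not)
open import Data.List using (List; allFin; upTo; filterᵇ; length; concatMap; map)
open import Data.Bool.ListAction using (any; all)
open import Data.Product using (Σ; ∃; _×_; _,_; proj₁; proj₂)
open import Data.Sum using (_⊎_)
open import Relation.Nullary using (¬_; does)
open import Relation.Binary.PropositionalEquality using (_≡_; _≢_)
open import Function.Bundles using (_⇔_)

record Graph (n : ℕ) : Set where
  field
    adj    : Fin n → Fin n → Bool
    sym    : ∀ u v → adj u v ≡ adj v u
    irrefl : ∀ v → adj v v ≡ false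
open Graph public

Adj : ∀ {n} → Graph n → Fin n → Fin n → Set
Adj G u v = adj G u v ≡ true

deg : ∀ {n} → Graph n → Fin n → ℕ
deg {n} G v = length (filterᵇ (adj G v) (allFin n))

numEdges : ∀ {n} → Graph n → ℕ
numEdges {n} G =
  length (filterᵇ (λ p → adj G (proj₁ p) (proj₂ p) ∧ (suc (toℕ (proj₁ p)) ≤ᵇ toℕ (proj₂ p)))
                  (concatMap (λ u → map (λ v → (u , v)) (allFin n)) (allFin n)))

MaxDegAtMost : ∀ {n} → Graph n → ℕ → Set
MaxDegAtMost {n} G r = ∀ (v : Fin n) → deg G v ≤ r

data Walk {n} (G : Graph n) : Fin n → Fin n → Set where
  [] : ∀ {v} → Walk G v v
  _∷_ : ∀ {u v w} → Adj G u v → Walk G v w → Walk G u w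

Connected : ∀ {n} → Graph n → Set
Connected {n} G = ∀ (u v : Fin n) → Walk G u v

-- A total k-colouring: colours on vertices and on edges (edge colour of
-- edge uv is ecol u v = ecol v u; values on non-edges are irrelevant),
-- such that adjacent/incident elements get different colours.
record TotalColouring {n} (G : Graph n) (k : ℕ) : Set where
  field
    vcol : Fin n → Fin k
    ecol : Fin n → Fin n → Fin k
    ecol-sym      : ∀ u v → Adj G u v → ecol u v ≡ ecol v u
    vertex-vertex : ∀ u v → Adj G u v → vcol u ≢ vcol v
    vertex-edge   : ∀ u v → Adj G u v → vcol u ≢ ecol u v
    edge-edge     : ∀ u v w → Adj G u v → Adj G u w → v ≢ w → ecol u v ≢ ecol u w

TotallyColourable : ∀ {n} → Graph n → ℕ → Set
TotallyColourable G k = TotalColouring G k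

RMinimal : ℕ → ∀ {n} → Graph n → Set
RMinimal r G =
  Connected G × MaxDegAtMost G r × ¬ TotallyColourable G (r + 2) ×
  (∀ (m : ℕ) (H : Graph m) → Connected H → MaxDegAtMost H r →
     ¬ TotallyColourable H (r + 2) → numEdges G ≤ numEdges H)

_^[_]_ : ∀ {A : Set} → (A → A) → ℕ → A → A
f ^[ zero ] x = x
f ^[ suc k ] x = f (f ^[ k ] x)

-- rot v is a cyclic permutation of the neighbourhood of v
-- (the clockwise order of the edges around v)
IsRotationSystem : ∀ {N} → Graph N → (Fin N → Fin N → Fin N) → Set
IsRotationSystem {N} P rot =
  (∀ v w → Adj P v w → Adj P v (rot v w)) ×
  (∀ v w w' → Adj P v w → Adj P v w' → ∃ λ k → rot v ^[ k ] w ≡ w')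

Dart : ℕ → Set
Dart N = Fin N × Fin N

faceStep : ∀ {N} → (Fin N → Fin N → Fin N) → Dart N → Dart N
faceStep rot (v , w) = (w , rot w v)

eqDartᵇ : ∀ {N} → Dart N → Dart N → Bool
eqDartᵇ (a , b) (c , d) = does (a ≟ᶠ c) ∧ does (b ≟ᶠ d)

leqDartᵇ : ∀ {N} → Dart N → Dart N → Bool
leqDartᵇ {N} (a , b) (c , d) = (toℕ a * N + toℕ b) ≤ᵇ (toℕ c * N + toℕ d)

allDarts : ∀ N → List (Dart N)
allDarts N = concatMap (λ u → map (λ v → (u , v)) (allFin N)) (allFin N)

-- a dart is the leader of its face if it is a dart of P and is the least
-- dart of its orbit under faceStep (orbits have length ≤ N * N)
isFaceLeaderᵇ : ∀ {N} → Graph N → (Fin N → Fin N → Fin N) → Dart N → Bool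
isFaceLeaderᵇ {N} P rot d =
  adj P (proj₁ d) (proj₂ d) ∧
  all (λ k → leqDartᵇ d (faceStep rot ^[ k ] d)) (upTo (N * N))

numFaces : ∀ {N} → Graph N → (Fin N → Fin N → Fin N) → ℕ
numFaces {N} P rot = length (filterᵇ (isFaceLeaderᵇ P rot) (allDarts N))

-- 1-planar drawings of G, given combinatorially through G^×.
-- Vertices of G^× : Fin (n + cr); true vertex u is  (u ↑ˡ cr),
-- false vertex (crossing) j is  (n ↑ʳ j).

record OnePlanarDrawing {n} (G : Graph n) : Set where
  field
    cr    : ℕ
    P     : Graph (n + cr)                     -- the plane graph G^×
    rot   : Fin (n + cr) → Fin (n + cr) → Fin (n + cr)
    rot-ok : IsRotationSystem P rot
    -- genus 0 (P is connected, as G is): Euler's formula V - E + F = 2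
    euler : (n + cr) + numFaces P rot ≡ numEdges P + 2
    false-deg  : ∀ (j : Fin cr) → deg P ((n ↑ʳ j)) ≡ 4
    false-nbrs : ∀ (j : Fin cr) w → Adj P ((n ↑ʳ j)) w → ∃ λ (u : Fin n) → w ≡ (u ↑ˡ cr)
    -- edges of G are the uncrossed true-true edges of G^× together with
    -- the pairs of opposite neighbours (in the rotation) of crossings
    edges : ∀ (u v : Fin n) → Adj G u v ⇔
              (Adj P ((u ↑ˡ cr)) ((v ↑ˡ cr)) ⊎
               (∃ λ (j : Fin cr) → Adj P ((n ↑ʳ j)) ((u ↑ˡ cr)) ×
                  rot ((n ↑ʳ j)) (rot ((n ↑ʳ j)) ((u ↑ˡ cr))) ≡ (v ↑ˡ cr)))
    -- each edge is drawn once: uncrossed or crossed at exactly one crossing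
    uncrossed-unique : ∀ (u v : Fin n) (j : Fin cr) →
              Adj P ((u ↑ˡ cr)) ((v ↑ˡ cr)) → Adj P ((n ↑ʳ j)) ((u ↑ˡ cr)) →
              rot ((n ↑ʳ j)) (rot ((n ↑ʳ j)) ((u ↑ˡ cr))) ≢ (v ↑ˡ cr)
    crossed-once : ∀ (u v : Fin n) (j j' : Fin cr) →
              Adj P ((n ↑ʳ j)) ((u ↑ˡ cr)) →
              rot ((n ↑ʳ j)) (rot ((n ↑ʳ j)) ((u ↑ˡ cr))) ≡ (v ↑ˡ cr) →
              Adj P ((n ↑ʳ j')) ((u ↑ˡ cr)) →
              rot ((n ↑ʳ j')) (rot ((n ↑ʳ j')) ((u ↑ˡ cr))) ≡ (v ↑ˡ cr) →
              j ≡ j'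
open OnePlanarDrawing public

module _ {n} {G : Graph n} (D : OnePlanarDrawing G) where
  private N = n + cr D

  FaceDegree : Dart N → ℕ → Set
  FaceDegree d k = Adj (P D) (proj₁ d) (proj₂ d) ×
                   (faceStep (rot D) ^[ k ] d ≡ d) ×
                   (∀ i → 1 ≤ i → i < k → faceStep (rot D) ^[ i ] d ≢ d)

  incidentᵇ : Dart N → ℕ → Fin N → Bool
  incidentᵇ d k v = any (λ i → does (proj₁ (faceStep (rot D) ^[ i ] d) ≟ᶠ v)) (upTo k)

  numSmallIncident : Dart N → ℕ → ℕ
  numSmallIncident d k =
    length (filterᵇ (λ v → incidentᵇ d k v ∧ (deg (P D) v ≤ᵇ 4)) (allFin N))

-- An edge xy of an r-minimal graph G (r ≥ 8) cannot have both ends of degree at most 4: delete xy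
-- if x and y have a common neighbour, and contract it otherwise. The result is connected, has
-- maximum degree at most r and fewer edges, so it has a total (r + 2)-colouring; this pulls back to G
-- except on x, y and xy, each of which sees at most 8 < r + 2 colours and can be recoloured.
-- In G^× a true vertex has at least its degree in G, adjacent true vertices are adjacent in G, and no
-- two crossings are adjacent. The boundary walk of a face of degree 5 has odd length, so it contains
-- an edge between two true vertices, and one of them has degree at least 5 in G^×.

module Submission where

open import Defs renaming (sym to adj-sym)
open import Data.Bool using (Bool; true; false; T; T?; _∧_; _∨_; not; if_then_else_)
open import Data.Bool.Properties
  using (T-≡; ∧-conicalˡ; ∧-zeroʳ; ∨-zeroʳ; not-involutive) renaming (_≟_ to _≟ᵇ_)
open import Data.Empty using (⊥; ⊥-elim)
open import Data.Fin using (Fin; zero; suc; toℕ; _↑ˡ_; _↑ʳ_; splitAt; punchIn; punchOut)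
open import Data.Fin.Properties
  using (toℕ-injective; any?; ¬∀⟶∃¬; splitAt-↑ˡ; splitAt-↑ʳ; splitAt⁻¹-↑ˡ; splitAt⁻¹-↑ʳ;
         punchIn-injective; punchInᵢ≢i; punchIn-punchOut)
  renaming (_≟_ to _≟ᶠ_)
open import Data.List
  using (List; []; _∷_; _++_; length; map; filterᵇ; allFin; upTo; concatMap; cartesianProduct)
open import Data.List.Properties using (length-++; length-map; length-tabulate; length-upTo)
open import Data.List.Membership.Propositional using (_∈_; _∉_; find; lose)
open import Data.List.Membership.Propositional.Properties
  using (∈-∃++; ∈-++⁻; ∈-++⁺ˡ; ∈-++⁺ʳ; ∈-filter⁺; ∈-filter⁻; ∈-map⁺; ∈-map⁻; ∈-allFin;
         ∈-cartesianProduct⁺; ∈-upTo⁺; ∈-upTo⁻)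
import Data.List.Membership.DecPropositional as DecMembership
open import Data.List.Relation.Unary.Any using (here; there)
open import Data.List.Relation.Unary.Any.Properties using (any⁺; any⁻)
open import Data.List.Relation.Unary.All as All using (lookup)
open import Data.List.Relation.Unary.Unique.Propositional using (Unique; []; _∷_)
import Data.List.Relation.Unary.Unique.Propositional.Properties as Unique
open import Data.Nat using (ℕ; zero; suc; _+_; _≤_; _<_; _≤ᵇ_; _≤?_; _<?_; z≤n; s≤s)
open import Data.Nat.Properties
  using (≤-trans; ≤-reflexive; ≤-antisym; +-suc; +-mono-≤; m≤n⇒m≤1+n; m≤m+n; ≤-pred;
         <-asym; ≮⇒≥; ≰⇒>; 1+n≰n; n≤1+n; ≤ᵇ-reflects-≤; <⇒≱; m<m+n; +-comm; +-monoʳ-≤; module ≤-Reasoning)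
open import Data.Product using (∃; _×_; _,_; proj₁; proj₂; swap)
open import Data.Sum using (_⊎_; inj₁; inj₂; [_,_]′)
open import Data.Vec.Functional using (updateAt)
open import Data.Vec.Functional.Properties using (updateAt-updates; updateAt-minimal)
open import Function using (_∘_; id; const; Equivalence)
open import Relation.Nullary using (¬_; Dec; yes; no; does; contradiction; ofʸ; ofⁿ)
open import Relation.Nullary.Decidable using (True; isYes≗does; _×-dec_; _⊎-dec_; toWitness; fromWitness)
open import Relation.Binary.PropositionalEquality
  using (_≡_; _≢_; refl; sym; trans; cong; cong₂; subst; subst₂; ≢-sym)

private variable
  A B : Set
  n m : ℕ

count : (A → Bool) → List A → ℕ
count p xs = length (filterᵇ p xs)

∈-filterᵇ⁺ : ∀ (p : A → Bool) {x xs} → x ∈ xs → p x ≡ true → x ∈ filterᵇ p xs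
∈-filterᵇ⁺ p x∈xs px = ∈-filter⁺ (T? ∘ p) x∈xs (Equivalence.from T-≡ px)

∈-filterᵇ⁻ : ∀ (p : A → Bool) {x} xs → x ∈ filterᵇ p xs → x ∈ xs × p x ≡ true
∈-filterᵇ⁻ p xs x∈ with x∈xs , px ← ∈-filter⁻ (T? ∘ p) {xs = xs} x∈ = x∈xs , Equivalence.to T-≡ px

unique-⊆⇒length≤ : ∀ {xs ys : List A} → Unique xs → (∀ {x} → x ∈ xs → x ∈ ys) →
                   length xs ≤ length ys
unique-⊆⇒length≤ {xs = []} _ _ = z≤n
unique-⊆⇒length≤ {xs = x ∷ xs} (x∉xs ∷ u) xs⊆ys with as , bs , refl ← ∈-∃++ (xs⊆ys (here refl)) =
  ≤-trans (s≤s (unique-⊆⇒length≤ u xs⊆as++bs)) (≤-reflexive (sym length-as++x∷bs))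
  where
  xs⊆as++bs : ∀ {z} → z ∈ xs → z ∈ as ++ bs
  xs⊆as++bs {z} z∈xs with ∈-++⁻ as (xs⊆ys (there z∈xs))
  ... | inj₁ z∈as         = ∈-++⁺ˡ z∈as
  ... | inj₂ (here refl)  = contradiction refl (lookup x∉xs z∈xs)
  ... | inj₂ (there z∈bs) = ∈-++⁺ʳ as z∈bs
  length-as++x∷bs : length (as ++ x ∷ bs) ≡ suc (length (as ++ bs))
  length-as++x∷bs = trans (length-++ as) (trans (+-suc (length as) _) (cong suc (sym (length-++ as))))

count≤length : ∀ (p : A → Bool) {xs} (L : List A) → Unique xs →
               (∀ a → p a ≡ true → a ∈ L) → count p xs ≤ length L
count≤length p {xs} L u p⊆L =
  unique-⊆⇒length≤ (Unique.filter⁺ (T? ∘ p) u) (λ a∈ → p⊆L _ (proj₂ (∈-filterᵇ⁻ p xs a∈)))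

count-injective : ∀ (p : A → Bool) (q : B → Bool) (f : A → B) {xs ys} (es : List B) →
                  Unique xs → Unique es → (∀ b → b ∈ ys) → (∀ {a a'} → f a ≡ f a' → a ≡ a') →
                  (∀ a → p a ≡ true → q (f a) ≡ true) → (∀ e → e ∈ es → q e ≡ true) →
                  (∀ a → p a ≡ true → ¬ f a ∈ es) →
                  length es + count p xs ≤ count q ys
count-injective p q f {xs} {ys} es u-xs u-es complete f-inj pq q-es fresh =
  ≤-trans (≤-reflexive (sym length-image))
          (unique-⊆⇒length≤ (Unique.++⁺ u-es (Unique.map⁺ f-inj (Unique.filter⁺ (T? ∘ p) u-xs)) disjoint) ⊆q)
  where
  image = map f (filterᵇ p xs)
  length-image : length (es ++ image) ≡ length es + count p xs
  length-image = trans (length-++ es) (cong (length es +_) (length-map f (filterᵇ p xs)))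
  disjoint : ∀ {b} → ¬ (b ∈ es × b ∈ image)
  disjoint (b∈es , b∈image) with a , a∈ , refl ← ∈-map⁻ f b∈image =
    fresh a (proj₂ (∈-filterᵇ⁻ p xs a∈)) b∈es
  ⊆q : ∀ {b} → b ∈ es ++ image → b ∈ filterᵇ q ys
  ⊆q {b} b∈ with ∈-++⁻ es b∈
  ... | inj₁ b∈es = ∈-filterᵇ⁺ q (complete b) (q-es b b∈es)
  ... | inj₂ b∈image with a , a∈ , refl ← ∈-map⁻ f b∈image =
    ∈-filterᵇ⁺ q (complete (f a)) (pq a (proj₂ (∈-filterᵇ⁻ p xs a∈)))

count-∧-split : ∀ (p q : A → Bool) xs →
                count p xs ≡ count (λ a → p a ∧ q a) xs + count (λ a → p a ∧ not (q a)) xs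
count-∧-split p q [] = refl
count-∧-split p q (x ∷ xs) with p x | q x
... | false | _     = count-∧-split p q xs
... | true  | true  = cong suc (count-∧-split p q xs)
... | true  | false = trans (cong suc (count-∧-split p q xs)) (sym (+-suc _ _))

count-mono : ∀ (p q : A → Bool) xs → (∀ a → p a ≡ true → q a ≡ true) → count p xs ≤ count q xs
count-mono p q [] _ = z≤n
count-mono p q (x ∷ xs) p⇒q with p x in px | q x in qx
... | true  | true  = s≤s (count-mono p q xs p⇒q)
... | true  | false = contradiction (trans (sym (p⇒q x px)) qx) λ ()
... | false | true  = m≤n⇒m≤1+n (count-mono p q xs p⇒q)
... | false | false = count-mono p q xs p⇒q

count-pos : ∀ (p : A → Bool) {x xs} → x ∈ xs → p x ≡ true → 1 ≤ count p xs
count-pos p {xs = xs} x∈xs px with filterᵇ p xs | ∈-filterᵇ⁺ p x∈xs px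
... | _ ∷ _ | _ = s≤s z≤n

freeColour : ∀ {k} (L : List (Fin k)) → length L < k → ∃ λ c → c ∉ L
freeColour {k} L |L|<k = ¬∀⟶∃¬ k (_∈ L) (_∈? L) (λ all∈L → 1+n≰n (≤-trans |L|<k (k≤|L| all∈L)))
  where
  open DecMembership (_≟ᶠ_ {k}) using (_∈?_)
  k≤|L| : (∀ c → c ∈ L) → k ≤ length L
  k≤|L| all∈L = ≤-trans (≤-reflexive (sym (length-tabulate id)))
                        (unique-⊆⇒length≤ (Unique.allFin⁺ k) (λ {c} _ → all∈L c))

Avoiding : ∀ {k} → (A → Fin k) → List A → Fin k → Set
Avoiding f L c = ∀ {v} → v ∈ L → c ≢ f v

avoiding : ∀ {k} (f g : A → Fin k) (L L' : List A) → length L + length L' < k →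
           ∃ λ c → Avoiding f L c × Avoiding g L' c
avoiding {k = k} f g L L' bound = fresh (freeColour (map f L ++ map g L') images<k)
  where
  images<k : length (map f L ++ map g L') < k
  images<k = ≤-trans (s≤s (≤-reflexive (trans (length-++ (map f L))
                                               (cong₂ _+_ (length-map f L) (length-map g L'))))) bound
  fresh : (∃ λ c → c ∉ map f L ++ map g L') → ∃ λ c → Avoiding f L c × Avoiding g L' c
  fresh (c , c∉) =
    c , (λ v∈L c≡fv → c∉ (∈-++⁺ˡ (subst (_∈ map f L) (sym c≡fv) (∈-map⁺ f v∈L))))
      , (λ v∈L' c≡gv → c∉ (∈-++⁺ʳ (map f L) (subst (_∈ map g L') (sym c≡gv) (∈-map⁺ g v∈L'))))

adj⇒≢ : ∀ (G : Graph n) {u v} → Adj G u v → u ≢ v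
adj⇒≢ G {u} uv refl = contradiction (trans (sym uv) (irrefl G u)) λ ()

Adj-sym : ∀ (G : Graph n) {u v} → Adj G u v → Adj G v u
Adj-sym G {u} {v} uv = trans (adj-sym G v u) uv

neighbours : Graph n → Fin n → List (Fin n)
neighbours {n} G u = filterᵇ (adj G u) (allFin n)

∈-neighbours : ∀ (G : Graph n) {u v} → Adj G u v → v ∈ neighbours G u
∈-neighbours G {u} {v} uv = ∈-filterᵇ⁺ (adj G u) (∈-allFin v) uv

dartᵇ : Graph n → Dart n → Bool
dartᵇ G (u , v) = adj G u v

forwardᵇ : Dart n → Bool
forwardᵇ (u , v) = suc (toℕ u) ≤ᵇ toℕ v

numDarts : Graph n → ℕ
numDarts {n} G = count (dartᵇ G) (allDarts n)

allDarts≡cartesianProduct : ∀ n → allDarts n ≡ cartesianProduct (allFin n) (allFin n)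
allDarts≡cartesianProduct n = go (allFin n)
  where
  go : ∀ (xs : List (Fin n)) →
       concatMap (λ u → map (u ,_) (allFin n)) xs ≡ cartesianProduct xs (allFin n)
  go []       = refl
  go (x ∷ xs) = cong (map (x ,_) (allFin n) ++_) (go xs)

unique-allDarts : ∀ n → Unique (allDarts n)
unique-allDarts n = subst Unique (sym (allDarts≡cartesianProduct n))
                          (Unique.cartesianProduct⁺ (Unique.allFin⁺ n) (Unique.allFin⁺ n))

∈-allDarts : ∀ (d : Dart n) → d ∈ allDarts n
∈-allDarts {n} (u , v) = subst ((u , v) ∈_) (sym (allDarts≡cartesianProduct n))
                               (∈-cartesianProduct⁺ (∈-allFin u) (∈-allFin v))

forwardᵇ-swap : ∀ {u v : Fin n} → u ≢ v → forwardᵇ (v , u) ≡ not (forwardᵇ (u , v))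
forwardᵇ-swap {u = u} {v} u≢v
  with suc (toℕ u) ≤ᵇ toℕ v | ≤ᵇ-reflects-≤ (suc (toℕ u)) (toℕ v)
     | suc (toℕ v) ≤ᵇ toℕ u | ≤ᵇ-reflects-≤ (suc (toℕ v)) (toℕ u)
... | true  | ofʸ u<v | true  | ofʸ v<u = contradiction v<u (<-asym u<v)
... | true  | _       | false | _       = refl
... | false | _       | true  | _       = refl
... | false | ofⁿ u≮v | false | ofⁿ v≮u =
  contradiction (toℕ-injective (≤-antisym (≮⇒≥ v≮u) (≮⇒≥ u≮v))) u≢v

backward⇒forward-swap : ∀ (G : Graph n) d → (dartᵇ G d ∧ not (forwardᵇ d)) ≡ true →
                        (dartᵇ G (swap d) ∧ forwardᵇ (swap d)) ≡ true
backward⇒forward-swap G (u , v) h with u ≟ᶠ v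
... | yes refl = contradiction (trans (sym h) (cong (_∧ _) (irrefl G u))) λ ()
... | no u≢v   = trans (cong₂ _∧_ (adj-sym G v u) (forwardᵇ-swap u≢v)) h

forward⇒backward-swap : ∀ (G : Graph n) d → (dartᵇ G d ∧ forwardᵇ d) ≡ true →
                        (dartᵇ G (swap d) ∧ not (forwardᵇ (swap d))) ≡ true
forward⇒backward-swap G (u , v) h with u ≟ᶠ v
... | yes refl = contradiction (trans (sym h) (cong (_∧ _) (irrefl G u))) λ ()
... | no u≢v   = trans (cong₂ (λ a b → a ∧ not b) (adj-sym G v u) (forwardᵇ-swap u≢v))
                       (trans (cong (adj G u v ∧_) (not-involutive (forwardᵇ (u , v)))) h)

numDarts≡numEdges+numEdges : ∀ (G : Graph n) → numDarts G ≡ numEdges G + numEdges G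
numDarts≡numEdges+numEdges {n} G =
  trans (count-∧-split (dartᵇ G) forwardᵇ (allDarts n))
        (cong (numEdges G +_) (≤-antisym (by-swap (backward⇒forward-swap G))
                                         (by-swap (forward⇒backward-swap G))))
  where
  by-swap : ∀ {p q : Dart n → Bool} → (∀ d → p d ≡ true → q (swap d) ≡ true) →
            count p (allDarts n) ≤ count q (allDarts n)
  by-swap {p} {q} p⇒q∘swap =
    count-injective p q swap [] (unique-allDarts n) [] ∈-allDarts (cong swap) p⇒q∘swap (λ _ ()) (λ _ _ ())

numEdges<-from-numDarts : ∀ (G : Graph n) (H : Graph m) → 2 + numDarts H ≤ numDarts G →
                          numEdges H < numEdges G
numEdges<-from-numDarts G H 2+dH≤dG = ≰⇒> λ eG≤eH →
  1+n≰n (≤-trans (n≤1+n _) (≤-trans 2+eH+eH≤eG+eG (+-mono-≤ eG≤eH eG≤eH)))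
  where
  2+eH+eH≤eG+eG : 2 + (numEdges H + numEdges H) ≤ numEdges G + numEdges G
  2+eH+eH≤eG+eG = subst₂ (λ a b → 2 + a ≤ b)
                   (numDarts≡numEdges+numEdges H) (numDarts≡numEdges+numEdges G) 2+dH≤dG

fewerEdges : ∀ (G : Graph n) (H : Graph m) {x y} → Adj G x y →
             (F : Dart m → Dart n) (F⁻¹ : Dart n → Dart m) → (∀ d → F⁻¹ (F d) ≡ d) →
             (∀ d → dartᵇ H d ≡ true → dartᵇ G (F d) ≡ true) →
             dartᵇ H (F⁻¹ (x , y)) ≡ false → dartᵇ H (F⁻¹ (y , x)) ≡ false →
             numEdges H < numEdges G
fewerEdges {n} {m} G H {x} {y} xy F F⁻¹ F⁻¹∘F darts¹ xy∉H yx∉H =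
  numEdges<-from-numDarts G H
    (count-injective (dartᵇ H) (dartᵇ G) F ((x , y) ∷ (y , x) ∷ [])
      (unique-allDarts m) (((λ e → adj⇒≢ G xy (cong proj₁ e)) All.∷ All.[]) ∷ (All.[] ∷ []))
      ∈-allDarts F-injective darts¹ xy-darts fresh)
  where
  F-injective : ∀ {d d'} → F d ≡ F d' → d ≡ d'
  F-injective {d} {d'} e = trans (sym (F⁻¹∘F d)) (trans (cong F⁻¹ e) (F⁻¹∘F d'))
  xy-darts : ∀ e → e ∈ (x , y) ∷ (y , x) ∷ [] → dartᵇ G e ≡ true
  xy-darts _ (here refl)         = xy
  xy-darts _ (there (here refl)) = Adj-sym G xy
  not-dart : ∀ {d e} → dartᵇ H d ≡ true → dartᵇ H (F⁻¹ e) ≡ false → F d ≢ e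
  not-dart {d} d∈H e∉H refl = contradiction (trans (sym d∈H) (trans (cong (dartᵇ H) (sym (F⁻¹∘F d))) e∉H)) λ ()
  fresh : ∀ d → dartᵇ H d ≡ true → F d ∉ (x , y) ∷ (y , x) ∷ []
  fresh d d∈H (here e)         = not-dart d∈H xy∉H e
  fresh d d∈H (there (here e)) = not-dart d∈H yx∉H e

_++ʷ_ : ∀ {G : Graph n} {a b c} → Walk G a b → Walk G b c → Walk G a c
[]      ++ʷ q = q
(e ∷ p) ++ʷ q = e ∷ (p ++ʷ q)

mapWalk : ∀ {G : Graph n} {H : Graph m} (φ : Fin n → Fin m) →
          (∀ {u v} → Adj G u v → Walk H (φ u) (φ v)) → ∀ {a b} → Walk G a b → Walk H (φ a) (φ b)
mapWalk φ step []      = []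
mapWalk φ step (e ∷ p) = step e ++ʷ mapWalk φ step p

connected-image : ∀ {G : Graph n} {H : Graph m} (φ : Fin n → Fin m) (ψ : Fin m → Fin n) →
                  (∀ a → φ (ψ a) ≡ a) → (∀ {u v} → Adj G u v → Walk H (φ u) (φ v)) →
                  Connected G → Connected H
connected-image {H = H} φ ψ φ∘ψ step conn a b =
  subst₂ (Walk H) (φ∘ψ a) (φ∘ψ b) (mapWalk φ step (conn (ψ a) (ψ b)))

SameEdge : Fin n → Fin n → Fin n → Fin n → Set
SameEdge x y u v = (u ≡ x × v ≡ y) ⊎ (u ≡ y × v ≡ x)

-- Opaque (as is ecolᴳ below), so that case splits on u ≟ᶠ x elsewhere do not rewrite inside it.
opaque
  sameEdge? : ∀ (x y u v : Fin n) → Dec (SameEdge x y u v)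
  sameEdge? x y u v = ((u ≟ᶠ x) ×-dec (v ≟ᶠ y)) ⊎-dec ((u ≟ᶠ y) ×-dec (v ≟ᶠ x))

sameEdge-sym : ∀ {x y u v : Fin n} → SameEdge x y u v → SameEdge x y v u
sameEdge-sym (inj₁ (u≡x , v≡y)) = inj₂ (v≡y , u≡x)
sameEdge-sym (inj₂ (u≡y , v≡x)) = inj₁ (v≡x , u≡y)

sameEdge-endpoint : ∀ {x y u v : Fin n} → SameEdge x y u v → u ≡ x ⊎ u ≡ y
sameEdge-endpoint (inj₁ (u≡x , _)) = inj₁ u≡x
sameEdge-endpoint (inj₂ (u≡y , _)) = inj₂ u≡y

sameEdge-unique : ∀ {x y u v w : Fin n} → x ≢ y → SameEdge x y u v → SameEdge x y u w → v ≡ w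
sameEdge-unique x≢y (inj₁ (_ , refl))    (inj₁ (_ , refl))    = refl
sameEdge-unique x≢y (inj₂ (_ , refl))    (inj₂ (_ , refl))    = refl
sameEdge-unique x≢y (inj₁ (refl , _))    (inj₂ (u≡y , _))     = contradiction u≡y x≢y
sameEdge-unique x≢y (inj₂ (refl , _))    (inj₁ (u≡x , _))     = contradiction (sym u≡x) x≢y

¬sameEdgeˡ : ∀ {x y u v : Fin n} → u ≢ x → u ≢ y → ¬ SameEdge x y u v
¬sameEdgeˡ u≢x u≢y s = [ u≢x , u≢y ]′ (sameEdge-endpoint s)

¬sameEdgeʳ : ∀ {x y u v : Fin n} → v ≢ x → v ≢ y → ¬ SameEdge x y u v
¬sameEdgeʳ v≢x v≢y (inj₁ (_ , v≡y)) = v≢y v≡y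
¬sameEdgeʳ v≢x v≢y (inj₂ (_ , v≡x)) = v≢x v≡x

-- A total colouring of H pulls back along φ to every element of G except the edge xy and its ends,
-- which are then recoloured greedily: each of them sees at most d + d colours.
module Extension {G : Graph n} {H : Graph m} (φ : Fin n → Fin m) {x y : Fin n} (xy : Adj G x y)
  (preserve : ∀ {u v} → Adj G u v → ¬ SameEdge x y u v → Adj H (φ u) (φ v))
  (separate : ∀ {u v w} → Adj G u v → Adj G u w → v ≢ w →
              ¬ SameEdge x y u v → ¬ SameEdge x y u w → φ v ≢ φ w)
  {k d : ℕ} (deg-x : deg G x ≤ d) (deg-y : deg G y ≤ d) (2d<k : d + d < k)
  (C : TotalColouring H k) where

  open TotalColouring C

  x≢y : x ≢ y
  x≢y = adj⇒≢ G xy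

  fewColours : ∀ {a b} → deg G a ≤ d → deg G b ≤ d → length (neighbours G a) + length (neighbours G b) < k
  fewColours da db = ≤-trans (s≤s (+-mono-≤ da db)) 2d<k

  ecol₀ : Fin n → Fin n → Fin k
  ecol₀ u v = ecol (φ u) (φ v)

  vcol₀ : Fin n → Fin k
  vcol₀ u = vcol (φ u)

  xyColour : ∃ λ c → Avoiding (ecol₀ x) (neighbours G x) c × Avoiding (ecol₀ y) (neighbours G y) c
  xyColour = avoiding (ecol₀ x) (ecol₀ y) (neighbours G x) (neighbours G y) (fewColours deg-x deg-y)

  opaque
    ecolᴳ : Fin n → Fin n → Fin k
    ecolᴳ u v with sameEdge? x y u v
    ... | yes _ = proj₁ xyColour
    ... | no  _ = ecol₀ u v

    ecolᴳ-xy : ∀ {u v} → SameEdge x y u v → ecolᴳ u v ≡ proj₁ xyColour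
    ecolᴳ-xy {u} {v} s with sameEdge? x y u v
    ... | yes _ = refl
    ... | no ¬s = contradiction s ¬s

    ecolᴳ-other : ∀ {u v} → ¬ SameEdge x y u v → ecolᴳ u v ≡ ecol₀ u v
    ecolᴳ-other {u} {v} ¬s with sameEdge? x y u v
    ... | yes s = contradiction s ¬s
    ... | no _  = refl

  xColour : ∃ λ c → Avoiding vcol₀ (neighbours G x) c × Avoiding (ecolᴳ x) (neighbours G x) c
  xColour = avoiding vcol₀ (ecolᴳ x) (neighbours G x) (neighbours G x) (fewColours deg-x deg-x)

  vcol₁ : Fin n → Fin k
  vcol₁ = updateAt vcol₀ x (const (proj₁ xColour))

  yColour : ∃ λ c → Avoiding vcol₁ (neighbours G y) c × Avoiding (ecolᴳ y) (neighbours G y) c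
  yColour = avoiding vcol₁ (ecolᴳ y) (neighbours G y) (neighbours G y) (fewColours deg-y deg-y)

  vcolᴳ : Fin n → Fin k
  vcolᴳ = updateAt vcol₁ y (const (proj₁ yColour))

  vcolᴳ-y : vcolᴳ y ≡ proj₁ yColour
  vcolᴳ-y = updateAt-updates y vcol₁

  vcolᴳ≢y : ∀ {u} → u ≢ y → vcolᴳ u ≡ vcol₁ u
  vcolᴳ≢y {u} u≢y = updateAt-minimal u y vcol₁ u≢y

  vcolᴳ-x : vcolᴳ x ≡ proj₁ xColour
  vcolᴳ-x = trans (vcolᴳ≢y x≢y) (updateAt-updates x vcol₀)

  vcolᴳ-other : ∀ {u} → u ≢ x → u ≢ y → vcolᴳ u ≡ vcol₀ u
  vcolᴳ-other {u} u≢x u≢y = trans (vcolᴳ≢y u≢y) (updateAt-minimal u x vcol₀ u≢x)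

  y-vs-neighbour : ∀ {v} → Adj G y v → vcolᴳ y ≢ vcolᴳ v
  y-vs-neighbour {v} yv e = proj₁ (proj₂ yColour) (∈-neighbours G yv)
    (trans (sym vcolᴳ-y) (trans e (vcolᴳ≢y (≢-sym (adj⇒≢ G yv)))))

  x-vs-neighbour : ∀ {v} → Adj G x v → v ≢ y → vcolᴳ x ≢ vcolᴳ v
  x-vs-neighbour {v} xv v≢y e = proj₁ (proj₂ xColour) (∈-neighbours G xv)
    (trans (sym vcolᴳ-x) (trans e (vcolᴳ-other (≢-sym (adj⇒≢ G xv)) v≢y)))

  vertex-vertexᴳ : ∀ u v → Adj G u v → vcolᴳ u ≢ vcolᴳ v
  vertex-vertexᴳ u v uv with u ≟ᶠ y | v ≟ᶠ y
  ... | yes refl | _        = y-vs-neighbour uv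
  ... | no _     | yes refl = ≢-sym (y-vs-neighbour (Adj-sym G uv))
  ... | no u≢y   | no v≢y with u ≟ᶠ x | v ≟ᶠ x
  ...   | yes refl | _        = x-vs-neighbour uv v≢y
  ...   | no _     | yes refl = ≢-sym (x-vs-neighbour (Adj-sym G uv) u≢y)
  ...   | no u≢x   | no v≢x   = λ e → vertex-vertex (φ u) (φ v) (preserve uv (¬sameEdgeˡ u≢x u≢y))
                                  (trans (sym (vcolᴳ-other u≢x u≢y)) (trans e (vcolᴳ-other v≢x v≢y)))

  vertex-edgeᴳ : ∀ u v → Adj G u v → vcolᴳ u ≢ ecolᴳ u v
  vertex-edgeᴳ u v uv with u ≟ᶠ y
  ... | yes refl = λ e → proj₂ (proj₂ yColour) (∈-neighbours G uv) (trans (sym vcolᴳ-y) e)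
  ... | no u≢y with u ≟ᶠ x
  ...   | yes refl = λ e → proj₂ (proj₂ xColour) (∈-neighbours G uv) (trans (sym vcolᴳ-x) e)
  ...   | no u≢x   = λ e → vertex-edge (φ u) (φ v) (preserve uv (¬sameEdgeˡ u≢x u≢y))
                       (trans (sym (vcolᴳ-other u≢x u≢y)) (trans e (ecolᴳ-other (¬sameEdgeˡ u≢x u≢y))))

  xyColour-fresh : ∀ {u w} → u ≡ x ⊎ u ≡ y → Adj G u w → ¬ SameEdge x y u w → proj₁ xyColour ≢ ecolᴳ u w
  xyColour-fresh (inj₁ refl) uw ¬s e = proj₁ (proj₂ xyColour) (∈-neighbours G uw) (trans e (ecolᴳ-other ¬s))
  xyColour-fresh (inj₂ refl) uw ¬s e = proj₂ (proj₂ xyColour) (∈-neighbours G uw) (trans e (ecolᴳ-other ¬s))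

  edge-edgeᴳ : ∀ u v w → Adj G u v → Adj G u w → v ≢ w → ecolᴳ u v ≢ ecolᴳ u w
  edge-edgeᴳ u v w uv uw v≢w with sameEdge? x y u v | sameEdge? x y u w
  ... | yes s  | yes s' = contradiction (sameEdge-unique x≢y s s') v≢w
  ... | yes s  | no ¬s' = λ e → xyColour-fresh (sameEdge-endpoint s) uw ¬s' (trans (sym (ecolᴳ-xy s)) e)
  ... | no ¬s  | yes s' = λ e → xyColour-fresh (sameEdge-endpoint s') uv ¬s (trans (sym (ecolᴳ-xy s')) (sym e))
  ... | no ¬s  | no ¬s' = λ e → edge-edge (φ u) (φ v) (φ w) (preserve uv ¬s) (preserve uw ¬s')
                                  (separate uv uw v≢w ¬s ¬s')
                                  (trans (sym (ecolᴳ-other ¬s)) (trans e (ecolᴳ-other ¬s')))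

  ecolᴳ-sym : ∀ u v → Adj G u v → ecolᴳ u v ≡ ecolᴳ v u
  ecolᴳ-sym u v uv with sameEdge? x y u v
  ... | yes s  = trans (ecolᴳ-xy s) (sym (ecolᴳ-xy (sameEdge-sym s)))
  ... | no ¬s  = trans (ecolᴳ-other ¬s)
                   (trans (ecol-sym (φ u) (φ v) (preserve uv ¬s)) (sym (ecolᴳ-other (¬s ∘ sameEdge-sym))))

  colouring : TotalColouring G k
  colouring = record
    { vcol          = vcolᴳ
    ; ecol          = ecolᴳ
    ; ecol-sym      = ecolᴳ-sym
    ; vertex-vertex = vertex-vertexᴳ
    ; vertex-edge   = vertex-edgeᴳ
    ; edge-edge     = edge-edgeᴳ
    }

record Reduction (r : ℕ) (G : Graph n) (x y : Fin n) : Set where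
  field
    {order}   : ℕ
    H         : Graph order
    φ         : Fin n → Fin order
    connected : Connected H
    maxDeg    : MaxDegAtMost H r
    fewer     : numEdges H < numEdges G
    preserve  : ∀ {u v} → Adj G u v → ¬ SameEdge x y u v → Adj H (φ u) (φ v)
    separate  : ∀ {u v w} → Adj G u v → Adj G u w → v ≢ w →
                ¬ SameEdge x y u v → ¬ SameEdge x y u w → φ v ≢ φ w

minimal⇒irreducible : ∀ {r d} {G : Graph n} {x y} → RMinimal r G → Adj G x y →
                      deg G x ≤ d → deg G y ≤ d → d + d < r + 2 → ¬ Reduction r G x y
minimal⇒irreducible (_ , _ , uncolourable , minimal) xy dx dy 2d<r+2 R =
  <⇒≱ fewer (minimal _ H connected maxDeg
    (uncolourable ∘ Extension.colouring φ xy preserve separate dx dy 2d<r+2))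
  where open Reduction R

module Deletion (G : Graph n) {x y : Fin n} (xy : Adj G x y) where

  sameEdgeᵇ : Fin n → Fin n → Bool
  sameEdgeᵇ u v = does (sameEdge? x y u v)

  sameEdgeᵇ-sym : ∀ u v → sameEdgeᵇ u v ≡ sameEdgeᵇ v u
  sameEdgeᵇ-sym u v with sameEdge? x y u v | sameEdge? x y v u
  ... | yes _  | yes _ = refl
  ... | no  _  | no  _ = refl
  ... | yes s  | no ¬s = contradiction (sameEdge-sym s) ¬s
  ... | no ¬s  | yes s = contradiction (sameEdge-sym s) ¬s

  H : Graph n
  H = record
    { adj    = λ u v → adj G u v ∧ not (sameEdgeᵇ u v)
    ; sym    = λ u v → cong₂ (λ a b → a ∧ not b) (adj-sym G u v) (sameEdgeᵇ-sym u v)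
    ; irrefl = λ v → cong (_∧ _) (irrefl G v)
    }

  H-adj : ∀ {u v} → Adj G u v → ¬ SameEdge x y u v → Adj H u v
  H-adj {u} {v} uv ¬s with sameEdge? x y u v
  ... | yes s = contradiction s ¬s
  ... | no _  = cong (_∧ true) uv

  H-¬adj : ∀ {u v} → SameEdge x y u v → adj H u v ≡ false
  H-¬adj {u} {v} s with sameEdge? x y u v
  ... | yes _  = ∧-zeroʳ (adj G u v)
  ... | no ¬s  = contradiction s ¬s

  reduction : ∀ {r} → Connected G → MaxDegAtMost G r →
              (∃ λ z → Adj G x z × Adj G y z) → Reduction r G x y
  reduction conn maxDeg (z , xz , yz) = record
    { H         = H
    ; φ         = id
    ; connected = connected-image id id (λ _ → refl) step conn
    ; maxDeg    = λ v → ≤-trans (count-mono (adj H v) (adj G v) (allFin n) (λ _ → ∧-conicalˡ _ _)) (maxDeg v)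
    ; fewer     = fewerEdges G H xy id id (λ _ → refl) (λ _ → ∧-conicalˡ _ _)
                             (H-¬adj (inj₁ (refl , refl))) (H-¬adj (inj₂ (refl , refl)))
    ; preserve  = H-adj
    ; separate  = λ _ _ v≢w _ _ → v≢w
    }
    where
    z≢x : z ≢ x
    z≢x = ≢-sym (adj⇒≢ G xz)
    z≢y : z ≢ y
    z≢y = ≢-sym (adj⇒≢ G yz)
    via-z : ∀ {u v} → Adj G u z → Adj G z v → Walk H u v
    via-z uz zv = H-adj uz (¬sameEdgeʳ z≢x z≢y) ∷ (H-adj zv (¬sameEdgeˡ z≢x z≢y) ∷ [])
    step : ∀ {u v} → Adj G u v → Walk H u v
    step {u} {v} uv with sameEdge? x y u v
    ... | yes (inj₁ (refl , refl)) = via-z xz (Adj-sym G yz)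
    ... | yes (inj₂ (refl , refl)) = via-z yz (Adj-sym G xz)
    ... | no ¬s                    = H-adj uv ¬s ∷ []

∨-introˡ : ∀ {a} b → a ≡ true → (a ∨ b) ≡ true
∨-introˡ b refl = refl

∨-introʳ : ∀ a {b} → b ≡ true → (a ∨ b) ≡ true
∨-introʳ a refl = ∨-zeroʳ a

∨-elim : ∀ a {b} → (a ∨ b) ≡ true → a ≡ true ⊎ b ≡ true
∨-elim true  _ = inj₁ refl
∨-elim false h = inj₂ h

-- The contraction of xy is encoded as the union of G and G ∘ σ (σ moves x onto y) restricted to
-- the vertices other than y; φ is the quotient map, with ι ∘ φ = μ merging y into x.
module Contraction {m} (G : Graph (suc m)) {x y : Fin (suc m)} (xy : Adj G x y) where

  x≢y : x ≢ y
  x≢y = adj⇒≢ G xy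

  ι : Fin m → Fin (suc m)
  ι = punchIn y

  σ μ : Fin (suc m) → Fin (suc m)
  σ = updateAt id x (const y)
  μ = updateAt id y (const x)

  σ-x : σ x ≡ y
  σ-x = updateAt-updates x id

  σ-other : ∀ {v} → v ≢ x → σ v ≡ v
  σ-other {v} v≢x = updateAt-minimal v x id v≢x

  μ-y : μ y ≡ x
  μ-y = updateAt-updates y id

  μ-other : ∀ {v} → v ≢ y → μ v ≡ v
  μ-other {v} v≢y = updateAt-minimal v y id v≢y

  μ∘σ : ∀ v → μ (σ v) ≡ μ v
  μ∘σ v with v ≟ᶠ x
  ... | yes refl = trans (cong μ σ-x) (trans μ-y (sym (μ-other x≢y)))
  ... | no v≢x   = cong μ (σ-other v≢x)

  μ≢y : ∀ v → μ v ≢ y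
  μ≢y v with v ≟ᶠ y
  ... | yes refl = x≢y ∘ trans (sym μ-y)
  ... | no v≢y   = v≢y ∘ trans (sym (μ-other v≢y))

  φ : Fin (suc m) → Fin m
  φ v = punchOut (≢-sym (μ≢y v))

  ι∘φ : ∀ v → ι (φ v) ≡ μ v
  ι∘φ v = punchIn-punchOut (≢-sym (μ≢y v))

  φ∘ι : ∀ a → φ (ι a) ≡ a
  φ∘ι a = punchIn-injective y _ _ (trans (ι∘φ (ι a)) (μ-other (punchInᵢ≢i y a)))

  φ∘σ : ∀ v → φ (σ v) ≡ φ v
  φ∘σ v = punchIn-injective y _ _ (trans (ι∘φ (σ v)) (trans (μ∘σ v) (sym (ι∘φ v))))

  φx≡φy : φ x ≡ φ y
  φx≡φy = punchIn-injective y _ _ (trans (ι∘φ x) (trans (μ-other x≢y) (trans (sym μ-y) (sym (ι∘φ y)))))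

  adjᵁ : Fin (suc m) → Fin (suc m) → Bool
  adjᵁ u v = adj G u v ∨ adj G (σ u) (σ v)

  H : Graph m
  H = record
    { adj    = λ a b → adjᵁ (ι a) (ι b)
    ; sym    = λ a b → cong₂ _∨_ (adj-sym G (ι a) (ι b)) (adj-sym G (σ (ι a)) (σ (ι b)))
    ; irrefl = λ a → cong₂ _∨_ (irrefl G (ι a)) (irrefl G (σ (ι a)))
    }

  adjᵁ-μ : ∀ {u v} → Adj G u v → ¬ SameEdge x y u v → adjᵁ (μ u) (μ v) ≡ true
  adjᵁ-μ {u} {v} uv ¬s with u ≟ᶠ y | v ≟ᶠ y
  ... | yes refl | yes refl = contradiction refl (adj⇒≢ G uv)
  ... | yes refl | no v≢y   = subst₂ (λ a b → adjᵁ a b ≡ true) (sym μ-y) (sym (μ-other v≢y))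
                                (∨-introʳ (adj G x v) (subst₂ (Adj G) (sym σ-x) (sym (σ-other v≢x)) uv))
    where
    v≢x : v ≢ x
    v≢x v≡x = ¬s (inj₂ (refl , v≡x))
  ... | no u≢y   | yes refl = subst₂ (λ a b → adjᵁ a b ≡ true) (sym (μ-other u≢y)) (sym μ-y)
                                (∨-introʳ (adj G u x) (subst₂ (Adj G) (sym (σ-other u≢x)) (sym σ-x) uv))
    where
    u≢x : u ≢ x
    u≢x u≡x = ¬s (inj₁ (u≡x , refl))
  ... | no u≢y   | no v≢y   = subst₂ (λ a b → adjᵁ a b ≡ true) (sym (μ-other u≢y)) (sym (μ-other v≢y))
                                (∨-introˡ _ uv)

  H-adj : ∀ {u v} → Adj G u v → ¬ SameEdge x y u v → Adj H (φ u) (φ v)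
  H-adj {u} {v} uv ¬s = subst₂ (λ a b → adjᵁ a b ≡ true) (sym (ι∘φ u)) (sym (ι∘φ v)) (adjᵁ-μ uv ¬s)

  μ-collision : ∀ {v w} → μ v ≡ μ w → v ≢ w → SameEdge x y v w
  μ-collision {v} {w} μv≡μw v≢w with v ≟ᶠ y | w ≟ᶠ y
  ... | yes refl | yes refl = contradiction refl v≢w
  ... | yes refl | no w≢y   = inj₂ (refl , trans (sym (μ-other w≢y)) (trans (sym μv≡μw) μ-y))
  ... | no v≢y   | yes refl = inj₁ (trans (sym (μ-other v≢y)) (trans μv≡μw μ-y) , refl)
  ... | no v≢y   | no w≢y   = contradiction (trans (sym (μ-other v≢y)) (trans μv≡μw (μ-other w≢y))) v≢w

  H-neighbour : ∀ {a b} → Adj H a b → ∃ λ t → (Adj G (ι a) t ⊎ Adj G (σ (ι a)) t) × φ t ≡ b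
  H-neighbour {a} {b} ab with ∨-elim (adj G (ι a) (ι b)) ab
  ... | inj₁ e = ι b , inj₁ e , φ∘ι b
  ... | inj₂ e = σ (ι b) , inj₂ e , trans (φ∘σ (ι b)) (φ∘ι b)

  H-maxDeg : ∀ {r} → MaxDegAtMost G r → deg G x + deg G y ≤ r → MaxDegAtMost H r
  H-maxDeg maxDeg dx+dy≤r a with ι a ≟ᶠ x
  ... | yes ιa≡x =
    ≤-trans (count≤length (adj H a) (map φ (neighbours G x ++ neighbours G y)) (Unique.allFin⁺ m) cover)
            (≤-trans (≤-reflexive length-images) dx+dy≤r)
    where
    length-images : length (map φ (neighbours G x ++ neighbours G y)) ≡ deg G x + deg G y
    length-images = trans (length-map φ (neighbours G x ++ neighbours G y)) (length-++ (neighbours G x))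
    cover : ∀ b → Adj H a b → b ∈ map φ (neighbours G x ++ neighbours G y)
    cover b ab with t , at , φt≡b ← H-neighbour ab = subst (_∈ _) φt≡b (∈-map⁺ φ (t∈ at))
      where
      t∈ : ∀ {t} → Adj G (ι a) t ⊎ Adj G (σ (ι a)) t → t ∈ neighbours G x ++ neighbours G y
      t∈ (inj₁ e) = ∈-++⁺ˡ (∈-neighbours G (subst (λ c → Adj G c _) ιa≡x e))
      t∈ (inj₂ e) = ∈-++⁺ʳ (neighbours G x)
                      (∈-neighbours G (subst (λ c → Adj G c _) (trans (cong σ ιa≡x) σ-x) e))
  ... | no ιa≢x =
    ≤-trans (count≤length (adj H a) (map φ (neighbours G (ι a))) (Unique.allFin⁺ m) cover)
            (≤-trans (≤-reflexive (length-map φ (neighbours G (ι a)))) (maxDeg (ι a)))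
    where
    cover : ∀ b → Adj H a b → b ∈ map φ (neighbours G (ι a))
    cover b ab with t , at , φt≡b ← H-neighbour ab = subst (_∈ _) φt≡b (∈-map⁺ φ (∈-neighbours G (t∈ at)))
      where
      t∈ : ∀ {t} → Adj G (ι a) t ⊎ Adj G (σ (ι a)) t → Adj G (ι a) t
      t∈ (inj₁ e) = e
      t∈ (inj₂ e) = subst (λ c → Adj G c _) (σ-other ιa≢x) e

  lift : Dart m → Dart (suc m)
  lift (a , b) = if adj G (ι a) (ι b) then (ι a , ι b) else (σ (ι a) , σ (ι b))

  project : Dart (suc m) → Dart m
  project (u , v) = (φ u , φ v)

  project∘lift : ∀ d → project (lift d) ≡ d
  project∘lift (a , b) with adj G (ι a) (ι b)
  ... | true  = cong₂ _,_ (φ∘ι a) (φ∘ι b)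
  ... | false = cong₂ _,_ (trans (φ∘σ (ι a)) (φ∘ι a)) (trans (φ∘σ (ι b)) (φ∘ι b))

  lift-dart : ∀ d → dartᵇ H d ≡ true → dartᵇ G (lift d) ≡ true
  lift-dart (a , b) h with adj G (ι a) (ι b) in e
  ... | true  = e
  ... | false = h

  project-loop : ∀ {u v} → φ u ≡ φ v → dartᵇ H (project (u , v)) ≡ false
  project-loop {u} φu≡φv = trans (cong (adj H (φ u)) (sym φu≡φv)) (irrefl H (φ u))

  reduction : ∀ {r} → Connected G → MaxDegAtMost G r → deg G x + deg G y ≤ r →
              (∀ z → Adj G x z → Adj G y z → ⊥) → Reduction r G x y
  reduction conn maxDeg dx+dy≤r noCommon = record
    { H         = H
    ; φ         = φ
    ; connected = connected-image φ ι φ∘ι step conn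
    ; maxDeg    = H-maxDeg maxDeg dx+dy≤r
    ; fewer     = fewerEdges G H xy lift project project∘lift lift-dart
                             (project-loop φx≡φy) (project-loop (sym φx≡φy))
    ; preserve  = H-adj
    ; separate  = separate
    }
    where
    step : ∀ {u v} → Adj G u v → Walk H (φ u) (φ v)
    step {u} {v} uv with sameEdge? x y u v
    ... | yes (inj₁ (refl , refl)) = subst (Walk H (φ x)) φx≡φy []
    ... | yes (inj₂ (refl , refl)) = subst (Walk H (φ y)) (sym φx≡φy) []
    ... | no ¬s                    = H-adj uv ¬s ∷ []
    separate : ∀ {u v w} → Adj G u v → Adj G u w → v ≢ w →
               ¬ SameEdge x y u v → ¬ SameEdge x y u w → φ v ≢ φ w
    separate {u} uv uw v≢w _ _ φv≡φw with μ-collision (trans (sym (ι∘φ _)) (trans (cong ι φv≡φw) (ι∘φ _))) v≢w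
    ... | inj₁ (refl , refl) = noCommon u (Adj-sym G uv) (Adj-sym G uw)
    ... | inj₂ (refl , refl) = noCommon u (Adj-sym G uw) (Adj-sym G uv)

edgeReduction : ∀ {n r} (G : Graph n) → Connected G → MaxDegAtMost G r →
                ∀ {x y} → Adj G x y → deg G x + deg G y ≤ r → Reduction r G x y
edgeReduction {zero}  G _ _ {()}
edgeReduction {suc _} G conn maxDeg {x} {y} xy dx+dy≤r
  with any? (λ z → (adj G x z ≟ᵇ true) ×-dec (adj G y z ≟ᵇ true))
... | yes common = Deletion.reduction G xy conn maxDeg common
... | no ¬common = Contraction.reduction G xy conn maxDeg dx+dy≤r (λ z xz yz → ¬common (z , xz , yz))

lightEdge : ∀ {r d} (G : Graph n) → d + d ≤ r → RMinimal r G →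
            ∀ {x y} → Adj G x y → deg G x ≤ d → deg G y ≤ d → ⊥
lightEdge {r = r} G 2d≤r rm@(conn , maxDeg , _) xy dx dy =
  minimal⇒irreducible rm xy dx dy (≤-trans (s≤s 2d≤r) (m<m+n r (s≤s z≤n)))
    (edgeReduction G conn maxDeg xy (≤-trans (+-mono-≤ dx dy) 2d≤r))

-- Crossings are independent in G^×, and a closed walk of odd length cannot alternate between
-- true vertices and crossings, so some edge of it joins two true vertices; one of them is large.
module Pentagon {V : Set} (E : V → V → Set) {Tr Cr Lg : V → Set} (kind : ∀ v → Tr v ⊎ Cr v)
  (Cr-next : ∀ {a b} → E a b → Cr a → Tr b) (Cr-prev : ∀ {a b} → E a b → Cr b → Tr a)
  (true-edge : ∀ {a b} → E a b → Tr a → Tr b → Lg a ⊎ Lg b)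
  (w : ℕ → V) (step : ∀ i → E (w i) (w (suc i))) (closed : w 5 ≡ w 0) where

  found : ∀ i {i<5 : True (i <? 5)} → Lg (w i) → ∃ λ i → i < 5 × Lg (w i)
  found i {i<5} l = i , toWitness i<5 , l

  edge : ∀ i j {i<5 : True (i <? 5)} {j<5 : True (j <? 5)} → w (suc i) ≡ w j →
         Tr (w i) → Tr (w (suc i)) → ∃ λ i → i < 5 × Lg (w i)
  edge i j {i<5} {j<5} next≡j ti tj =
    [ found i {i<5} , found j {j<5} ∘ subst Lg next≡j ]′ (true-edge (step i) ti tj)

  large : ∃ λ i → i < 5 × Lg (w i)
  large with kind (w 0)
  ... | inj₁ t0 with kind (w 1)
  ...   | inj₁ t1 = edge 0 1 refl t0 t1
  ...   | inj₂ f1 with kind (w 3)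
  ...     | inj₁ t3 = edge 2 3 refl (Cr-next (step 1) f1) t3
  ...     | inj₂ f3 = edge 4 0 closed (Cr-next (step 3) f3) (subst Tr (sym closed) t0)
  large | inj₂ f0 with kind (w 2)
  ...   | inj₁ t2 = edge 1 2 refl (Cr-next (step 0) f0) t2
  ...   | inj₂ f2 = edge 3 4 refl (Cr-next (step 2) f2) (Cr-prev (step 4) (subst Cr (sym closed) f0))

<⇒≤ᵇ≡false : ∀ {m n} → m < n → (n ≤ᵇ m) ≡ false
<⇒≤ᵇ≡false {m} {n} m<n with n ≤ᵇ m | ≤ᵇ-reflects-≤ n m
... | true  | ofʸ n≤m = contradiction n≤m (<⇒≱ m<n)
... | false | _       = refl

module Drawing {G : Graph n} (D : OnePlanarDrawing G) where

  N : ℕ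
  N = n + cr D

  IsTrue IsCrossing : Fin N → Set
  IsTrue v     = ∃ λ u → v ≡ u ↑ˡ cr D
  IsCrossing v = ∃ λ j → v ≡ n ↑ʳ j

  vertexKind : ∀ v → IsTrue v ⊎ IsCrossing v
  vertexKind v with splitAt n v in e
  ... | inj₁ u = inj₁ (u , sym (splitAt⁻¹-↑ˡ e))
  ... | inj₂ j = inj₂ (j , sym (splitAt⁻¹-↑ʳ e))

  crossing-neighbour : ∀ {a b} → Adj (P D) a b → IsCrossing a → IsTrue b
  crossing-neighbour ab (j , refl) = false-nbrs D j _ ab

  -- The vertex of G reached from u along an edge of G^× to w (junk value u if that is not a vertex of G).
  across : Fin n → Fin N → Fin n
  across u w = [ id , (λ j → fromTrue (rot D (n ↑ʳ j) (rot D (n ↑ʳ j) (u ↑ˡ cr D)))) ]′ (splitAt n w)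
    where
    fromTrue : Fin N → Fin n
    fromTrue v = [ id , const u ]′ (splitAt n v)

  across-true : ∀ u v → across u (v ↑ˡ cr D) ≡ v
  across-true u v = cong [ id , _ ]′ (splitAt-↑ˡ n v (cr D))

  across-crossing : ∀ u v j → rot D (n ↑ʳ j) (rot D (n ↑ʳ j) (u ↑ˡ cr D)) ≡ v ↑ˡ cr D →
                    across u (n ↑ʳ j) ≡ v
  across-crossing u v j opposite rewrite splitAt-↑ʳ n (cr D) j | opposite | splitAt-↑ˡ n v (cr D) = refl

  deg≤deg× : ∀ u → deg G u ≤ deg (P D) (u ↑ˡ cr D)
  deg≤deg× u = ≤-trans (count≤length (adj G u) (map (across u) (neighbours (P D) (u ↑ˡ cr D)))
                                     (Unique.allFin⁺ n) cover)
                       (≤-reflexive (length-map (across u) (neighbours (P D) (u ↑ˡ cr D))))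
    where
    cover : ∀ v → Adj G u v → v ∈ map (across u) (neighbours (P D) (u ↑ˡ cr D))
    cover v uv with Equivalence.to (edges D u v) uv
    ... | inj₁ uncrossed = subst (_∈ _) (across-true u v) (∈-map⁺ (across u) (∈-neighbours (P D) uncrossed))
    ... | inj₂ (j , ju , opposite) = subst (_∈ _) (across-crossing u v j opposite)
                                       (∈-map⁺ (across u) (∈-neighbours (P D) (Adj-sym (P D) ju)))

  Large : Fin N → Set
  Large v = 4 < deg (P D) v

  true-edge-large : ∀ {r} → 8 ≤ r → RMinimal r G →
                    ∀ {a b} → Adj (P D) a b → IsTrue a → IsTrue b → Large a ⊎ Large b
  true-edge-large 8≤r rm {a} {b} ab (u , refl) (v , refl) with deg (P D) a ≤? 4 | deg (P D) b ≤? 4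
  ... | no a≰4  | _       = inj₁ (≰⇒> a≰4)
  ... | yes _   | no b≰4  = inj₂ (≰⇒> b≰4)
  ... | yes a≤4 | yes b≤4 = ⊥-elim (lightEdge G 8≤r rm (Equivalence.from (edges D u v) (inj₁ ab))
                                      (≤-trans (deg≤deg× u) a≤4) (≤-trans (deg≤deg× v) b≤4))

  module Face (d : Dart N) where

    boundary : ℕ → Fin N
    boundary i = proj₁ (faceStep (rot D) ^[ i ] d)

    boundary-adj : Adj (P D) (proj₁ d) (proj₂ d) → ∀ i → Adj (P D) (boundary i) (boundary (suc i))
    boundary-adj d∈P zero    = d∈P
    boundary-adj d∈P (suc i) = proj₁ (rot-ok D) _ _ (Adj-sym (P D) (boundary-adj d∈P i))

    incident⇒boundary : ∀ {k v} → incidentᵇ D d k v ≡ true → ∃ λ i → i < k × boundary i ≡ v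
    incident⇒boundary {k} h with i , i∈ , hit ← find (any⁻ _ (upTo k) (Equivalence.from T-≡ h)) =
      i , ∈-upTo⁻ i∈ , toWitness (subst T (sym (isYes≗does (boundary i ≟ᶠ _))) hit)

    boundary⇒incident : ∀ {k i} → i < k → incidentᵇ D d k (boundary i) ≡ true
    boundary⇒incident {i = i} i<k =
      Equivalence.to T-≡ (any⁺ _ (lose (∈-upTo⁺ i<k)
        (subst T (isYes≗does (boundary i ≟ᶠ boundary i)) (fromWitness refl))))

    numIncident≤ : ∀ k → count (incidentᵇ D d k) (allFin N) ≤ k
    numIncident≤ k = ≤-trans (count≤length _ (map boundary (upTo k)) (Unique.allFin⁺ N) cover)
                             (≤-reflexive (trans (length-map boundary (upTo k)) (length-upTo k)))
      where
      cover : ∀ v → incidentᵇ D d k v ≡ true → v ∈ map boundary (upTo k)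
      cover v h with i , i<k , bᵢ≡v ← incident⇒boundary h = subst (_∈ _) bᵢ≡v (∈-map⁺ boundary (∈-upTo⁺ i<k))

    numSmallIncident< : ∀ {k i} → i < k → Large (boundary i) → numSmallIncident D d k < k
    numSmallIncident< {k} {i} i<k large = begin
      suc (numSmallIncident D d k)                  ≡⟨ +-comm 1 _ ⟩
      numSmallIncident D d k + 1                    ≤⟨ +-monoʳ-≤ _ largeIncident ⟩
      numSmallIncident D d k + count incidentLarge (allFin N)
                                                    ≡⟨ count-∧-split (incidentᵇ D d k) small (allFin N) ⟨
      count (incidentᵇ D d k) (allFin N)            ≤⟨ numIncident≤ k ⟩
      k                                             ∎
      where
      open ≤-Reasoning
      small incidentLarge : Fin N → Bool
      small v         = deg (P D) v ≤ᵇ 4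
      incidentLarge v = incidentᵇ D d k v ∧ not (small v)
      largeIncident : 1 ≤ count incidentLarge (allFin N)
      largeIncident = count-pos incidentLarge (∈-allFin (boundary i))
        (cong₂ _∧_ (boundary⇒incident i<k) (cong not (<⇒≤ᵇ≡false large)))

lemma2p8 : (r : ℕ) → 13 ≤ r → {n : ℕ} (G : Graph n) → RMinimal r G →
    (D : OnePlanarDrawing G) → (∀ (D' : OnePlanarDrawing G) → cr D ≤ cr D') →
    (d : Fin (n + cr D) × Fin (n + cr D)) → FaceDegree D d 5 →
    numSmallIncident D d 5 ≤ 4
lemma2p8 r 13≤r G rm D _ d (d∈P , closed , _) =
  ≤-pred (numSmallIncident< (proj₁ (proj₂ large)) (proj₂ (proj₂ large)))
  where
  open Drawing D
  open Face d
  large : ∃ λ i → i < 5 × Large (boundary i)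
  large = Pentagon.large (λ a b → Adj (P D) a b) vertexKind crossing-neighbour
                         (crossing-neighbour ∘ Adj-sym (P D)) (true-edge-large (≤-trans (m≤m+n 8 5) 13≤r) rm)
                         boundary (boundary-adj d∈P) (cong proj₁ closed)
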